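{- Let $q$ be an odd prime power and let $B(X) = A(X^2) \in \mathbb{F}_q[X]$ be a monic irreducible polynomial of degree $2n \geq 2$ with $\gcd(n, q) = 1$. Then for any $a \in \mathbb{F}_q$ with $a \neq 0$, the polynomial $F(X) = B(X + a) = \sum_{i=0}^{2n} f_i X^i$ is irreducible over $\mathbb{F}_q$ and has at least one coefficient $f_i \neq 0$ with $i$ odd, $0 \leq i < 2n$. -}

module Defs where

open import Level using (Level; _⊔_)
open import Data.Nat as ℕ using (ℕ; zero; suc; _^_)
open import Data.Nat.Primality using (Prime)
open import Data.List using (List; []; _∷_; length)
open import Data.List.Membership.Setoid using () renaming (_∈_ to _∈ₛ_)
open import Data.List.Relation.Unary.AllPairs using (AllPairs)
open import Data.Product using (Σ; ∃; ∃-syntax; _×_; _,_)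
open import Data.Sum using (_⊎_)
open import Relation.Nullary using (¬_)
open import Relation.Binary.PropositionalEquality using (_≡_)
open import Algebra.Bundles using (CommutativeRing)

IsPrimePower : ℕ → Set
IsPrimePower q = Σ ℕ λ p → Σ ℕ λ k → Prime p × 1 ℕ.≤ k × q ≡ p ^ k

record FiniteField (c ℓ : Level) (q : ℕ) : Set (Level.suc (c ⊔ ℓ)) where
  field
    commRing  : CommutativeRing c ℓ
  open CommutativeRing commRing
  field
    nontrivial : ¬ (1# ≈ 0#)
    inverse    : ∀ x → ¬ (x ≈ 0#) → ∃[ y ] (x * y ≈ 1#)
    elements   : List Carrier
    complete   : ∀ x → _∈ₛ_ setoid x elements
    distinct   : AllPairs (λ x y → ¬ (x ≈ y)) elements
    size       : length elements ≡ q

-- Univariate polynomials over a commutative ring, as coefficient lists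
-- (constant term first).  Polynomial equality is coefficientwise (so
-- trailing zeros are irrelevant).
module Poly {c ℓ} (R : CommutativeRing c ℓ) where
  open CommutativeRing R public using (Carrier; _≈_; 0#; 1#)
  open CommutativeRing R using (_+_; _*_)

  Pol : Set c
  Pol = List Carrier

  coeff : Pol → ℕ → Carrier
  coeff []       _       = 0#
  coeff (x ∷ _)  zero    = x
  coeff (_ ∷ xs) (suc i) = coeff xs i

  _≃_ : Pol → Pol → Set ℓ
  p ≃ q = ∀ i → coeff p i ≈ coeff q i

  _⊕_ : Pol → Pol → Pol
  []       ⊕ q        = q
  (x ∷ p)  ⊕ []       = x ∷ p
  (x ∷ p)  ⊕ (y ∷ q)  = (x + y) ∷ (p ⊕ q)

  scale : Carrier → Pol → Pol
  scale a []       = []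
  scale a (x ∷ p)  = (a * x) ∷ scale a p

  _⊗_ : Pol → Pol → Pol
  []      ⊗ q = []
  (x ∷ p) ⊗ q = scale x q ⊕ (0# ∷ (p ⊗ q))

  _∘ₚ_ : Pol → Pol → Pol
  []      ∘ₚ q = []
  (x ∷ p) ∘ₚ q = (x ∷ []) ⊕ (q ⊗ (p ∘ₚ q))

  X : Pol
  X = 0# ∷ 1# ∷ []

  HasDegree : Pol → ℕ → Set ℓ
  HasDegree p d = ¬ (coeff p d ≈ 0#) × (∀ i → d ℕ.< i → coeff p i ≈ 0#)

  MonicOfDegree : Pol → ℕ → Set ℓ
  MonicOfDegree p d = coeff p d ≈ 1# × (∀ i → d ℕ.< i → coeff p i ≈ 0#)

  -- units of K[X] for a field K are the nonzero constants (degree 0)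
  -- irreducible: not zero, not a unit, and every factorisation has a unit factor
  Irreducible : Pol → Set (c ⊔ ℓ)
  Irreducible p =
    (∃[ d ] (1 ℕ.≤ d × HasDegree p d)) ×
    (∀ g h → p ≃ (g ⊗ h) → HasDegree g 0 ⊎ HasDegree h 0)

module Submission where

-- Composition p ↦ p ∘ₚ r is a ring homomorphism of K[X], it is
-- associative, and (X + a) ∘ₚ (X - a) = (X - a) ∘ₚ (X + a) = X.  Hence the
-- shift p ↦ p(X + a) preserves degrees, and a factorisation of B(X + a) pulls
-- back along X ↦ X - a to one of B: B(X + a) is irreducible.  For the odd
-- coefficient: if deg p ≤ d + 1, the coefficient of X^d in p(X + a) is
-- p_d + (d + 1)·a·p_{d+1}; for B = A(X²) monic of degree 2n and d = 2n - 1
-- this is 0 + 2n·a.  Finally 2n·a ≠ 0 in 𝔽_q: x ↦ 1 + x permutes 𝔽_q, so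
-- Σ x = q·1 + Σ x and q·1 = 0; a relation 1 + u·k = v·q (Bézout for k = n,
-- division by 2 for k = 2) then rules out k·1 = 0, and fields have no zero
-- divisors.

open import Defs
open import Level using (Level)
open import Data.Nat using (ℕ; _*_; _<_; _≤_; _%_)
open import Data.Nat.GCD using (gcd)
open import Data.List using (_∷_; [])
open import Data.Product using (_×_; ∃-syntax)
open import Relation.Nullary using (¬_)
open import Relation.Binary.PropositionalEquality using (_≡_)

import Data.Nat as ℕ
import Data.Nat.Properties as ℕₚ
import Data.Nat.DivMod as DivMod
import Data.Nat.GCD as GCD
import Data.List.Properties as ListProperties
import Relation.Binary.PropositionalEquality as ≡
import Relation.Binary.Reasoning.Setoid as SetoidReasoning
import Algebra.Properties.CommutativeSemigroup as CommutativeSemigroupProperties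
import Algebra.Properties.Group as GroupProperties
import Algebra.Properties.Semiring.Mult as MultProperties
open import Data.Nat using (zero; suc; s≤s; z≤n)
open import Data.List using (List; length; map; foldr)
open import Data.List.Relation.Unary.Any using (here; there; _─_; index)
open import Data.List.Relation.Unary.All using (All; []; _∷_)
import Data.List.Relation.Unary.All as All
open import Data.List.Relation.Unary.AllPairs using (AllPairs; []; _∷_)
import Data.List.Relation.Unary.AllPairs as AllPairs
import Data.List.Relation.Unary.AllPairs.Properties as AllPairsProperties
open import Data.Product using (_,_)
open import Data.Sum using (_⊎_)
import Data.Sum as Sum
open import Data.Empty using (⊥-elim)
open import Relation.Binary.Bundles using (Setoid)
open import Algebra.Bundles using (CommutativeRing; CommutativeMonoid)

module Polynomials {c ℓ} (R : CommutativeRing c ℓ) where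
  open CommutativeRing R hiding (zero) renaming (_*_ to _·_)
  open Poly R using (Pol; coeff; _≃_; _⊕_; scale; _⊗_; _∘ₚ_; X; HasDegree; MonicOfDegree; Irreducible)
  open CommutativeSemigroupProperties +-commutativeSemigroup using (interchange; x∙yz≈y∙xz)
  open MultProperties semiring using () renaming (_×_ to _times_)

  module ≈-Reasoning = SetoidReasoning setoid

  -- Coefficientwise equality _≃_, wrapped in a record so that the two
  -- polynomials can be inferred from a proof.
  infix 4 _≈ₚ_
  record _≈ₚ_ (p r : Pol) : Set ℓ where
    constructor coeffwise
    field at : p ≃ r
  open _≈ₚ_ public

  ≈ₚ-setoid : Setoid c ℓ
  ≈ₚ-setoid = record
    { Carrier       = Pol
    ; _≈_           = _≈ₚ_
    ; isEquivalence = record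
      { refl  = coeffwise λ _ → refl
      ; sym   = λ e → coeffwise λ i → sym (at e i)
      ; trans = λ e f → coeffwise λ i → trans (at e i) (at f i)
      }
    }

  open Setoid ≈ₚ-setoid public using () renaming (refl to ≈ₚ-refl; sym to ≈ₚ-sym; trans to ≈ₚ-trans)
  module ≈ₚ-Reasoning = SetoidReasoning ≈ₚ-setoid

  coeff-⊕ : ∀ p r i → coeff (p ⊕ r) i ≈ coeff p i + coeff r i
  coeff-⊕ []      r       i       = sym (+-identityˡ _)
  coeff-⊕ (x ∷ p) []      zero    = sym (+-identityʳ x)
  coeff-⊕ (x ∷ p) []      (suc i) = sym (+-identityʳ _)
  coeff-⊕ (x ∷ p) (y ∷ r) zero    = refl
  coeff-⊕ (x ∷ p) (y ∷ r) (suc i) = coeff-⊕ p r i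

  coeff-scale : ∀ a p i → coeff (scale a p) i ≈ a · coeff p i
  coeff-scale a []      i       = sym (zeroʳ a)
  coeff-scale a (x ∷ p) zero    = refl
  coeff-scale a (x ∷ p) (suc i) = coeff-scale a p i

  ∷-cong : ∀ {x y p r} → x ≈ y → p ≈ₚ r → (x ∷ p) ≈ₚ (y ∷ r)
  ∷-cong e f = coeffwise λ { zero → e ; (suc i) → at f i }

  ∷-≈ₚ[] : ∀ {x p} → x ≈ 0# → p ≈ₚ [] → (x ∷ p) ≈ₚ []
  ∷-≈ₚ[] e f = coeffwise λ { zero → e ; (suc i) → at f i }

  tail-≈ₚ : ∀ {x y p r} → (x ∷ p) ≈ₚ (y ∷ r) → p ≈ₚ r
  tail-≈ₚ e = coeffwise λ i → at e (suc i)

  tail-≈ₚ[] : ∀ {x p} → (x ∷ p) ≈ₚ [] → p ≈ₚ []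
  tail-≈ₚ[] e = coeffwise λ i → at e (suc i)

  ⊕-cong : ∀ {p p′ r r′} → p ≈ₚ p′ → r ≈ₚ r′ → (p ⊕ r) ≈ₚ (p′ ⊕ r′)
  ⊕-cong {p} {p′} {r} {r′} e f = coeffwise λ i →
    trans (coeff-⊕ p r i) (trans (+-cong (at e i) (at f i)) (sym (coeff-⊕ p′ r′ i)))

  scale-cong : ∀ {a b p p′} → a ≈ b → p ≈ₚ p′ → scale a p ≈ₚ scale b p′
  scale-cong {a} {b} {p} {p′} e f = coeffwise λ i →
    trans (coeff-scale a p i) (trans (*-cong e (at f i)) (sym (coeff-scale b p′ i)))

  ⊕-identityʳ : ∀ p → (p ⊕ []) ≈ₚ p
  ⊕-identityʳ []      = ≈ₚ-refl
  ⊕-identityʳ (x ∷ p) = ≈ₚ-refl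

  ⊕-interchange : ∀ p r u v → ((p ⊕ r) ⊕ (u ⊕ v)) ≈ₚ ((p ⊕ u) ⊕ (r ⊕ v))
  ⊕-interchange p r u v = coeffwise λ i → begin
    coeff ((p ⊕ r) ⊕ (u ⊕ v)) i                       ≈⟨ coeff-⊕ (p ⊕ r) (u ⊕ v) i ⟩
    coeff (p ⊕ r) i + coeff (u ⊕ v) i                 ≈⟨ +-cong (coeff-⊕ p r i) (coeff-⊕ u v i) ⟩
    (coeff p i + coeff r i) + (coeff u i + coeff v i) ≈⟨ interchange _ _ _ _ ⟩
    (coeff p i + coeff u i) + (coeff r i + coeff v i) ≈⟨ sym (+-cong (coeff-⊕ p u i) (coeff-⊕ r v i)) ⟩
    coeff (p ⊕ u) i + coeff (r ⊕ v) i                 ≈⟨ sym (coeff-⊕ (p ⊕ u) (r ⊕ v) i) ⟩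
    coeff ((p ⊕ u) ⊕ (r ⊕ v)) i                       ∎
    where open ≈-Reasoning

  scale-zero : ∀ p → scale 0# p ≈ₚ []
  scale-zero p = coeffwise λ i → trans (coeff-scale 0# p i) (zeroˡ _)

  scale-one : ∀ p → scale 1# p ≈ₚ p
  scale-one p = coeffwise λ i → trans (coeff-scale 1# p i) (*-identityˡ _)

  scale-assoc : ∀ a b p → scale (a · b) p ≈ₚ scale a (scale b p)
  scale-assoc a b p = coeffwise λ i → begin
    coeff (scale (a · b) p) i  ≈⟨ coeff-scale (a · b) p i ⟩
    (a · b) · coeff p i        ≈⟨ *-assoc a b _ ⟩
    a · (b · coeff p i)        ≈⟨ *-cong refl (sym (coeff-scale b p i)) ⟩
    a · coeff (scale b p) i    ≈⟨ sym (coeff-scale a (scale b p) i) ⟩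
    coeff (scale a (scale b p)) i ∎
    where open ≈-Reasoning

  scale-comm : ∀ a b p → scale a (scale b p) ≈ₚ scale b (scale a p)
  scale-comm a b p = begin
    scale a (scale b p) ≈⟨ ≈ₚ-sym (scale-assoc a b p) ⟩
    scale (a · b) p     ≈⟨ scale-cong (*-comm a b) ≈ₚ-refl ⟩
    scale (b · a) p     ≈⟨ scale-assoc b a p ⟩
    scale b (scale a p) ∎
    where open ≈ₚ-Reasoning

  scale-distribˡ : ∀ a p r → scale a (p ⊕ r) ≈ₚ (scale a p ⊕ scale a r)
  scale-distribˡ a p r = coeffwise λ i → begin
    coeff (scale a (p ⊕ r)) i                   ≈⟨ coeff-scale a (p ⊕ r) i ⟩
    a · coeff (p ⊕ r) i                         ≈⟨ *-cong refl (coeff-⊕ p r i) ⟩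
    a · (coeff p i + coeff r i)                 ≈⟨ distribˡ a _ _ ⟩
    a · coeff p i + a · coeff r i               ≈⟨ sym (+-cong (coeff-scale a p i) (coeff-scale a r i)) ⟩
    coeff (scale a p) i + coeff (scale a r) i   ≈⟨ sym (coeff-⊕ (scale a p) (scale a r) i) ⟩
    coeff (scale a p ⊕ scale a r) i             ∎
    where open ≈-Reasoning

  scale-distribʳ : ∀ a b p → scale (a + b) p ≈ₚ (scale a p ⊕ scale b p)
  scale-distribʳ a b p = coeffwise λ i → begin
    coeff (scale (a + b) p) i                   ≈⟨ coeff-scale (a + b) p i ⟩
    (a + b) · coeff p i                         ≈⟨ distribʳ _ a b ⟩
    a · coeff p i + b · coeff p i               ≈⟨ sym (+-cong (coeff-scale a p i) (coeff-scale b p i)) ⟩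
    coeff (scale a p) i + coeff (scale b p) i   ≈⟨ sym (coeff-⊕ (scale a p) (scale b p) i) ⟩
    coeff (scale a p ⊕ scale b p) i             ∎
    where open ≈-Reasoning

  ⊗-zeroʳ : ∀ p → (p ⊗ []) ≈ₚ []
  ⊗-zeroʳ []      = ≈ₚ-refl
  ⊗-zeroʳ (x ∷ p) = ∷-≈ₚ[] refl (⊗-zeroʳ p)

  ⊗-zeroˡ : ∀ p r → p ≈ₚ [] → (p ⊗ r) ≈ₚ []
  ⊗-zeroˡ []      r e = ≈ₚ-refl
  ⊗-zeroˡ (x ∷ p) r e =
    ⊕-cong (≈ₚ-trans (scale-cong (at e zero) ≈ₚ-refl) (scale-zero r))
           (∷-≈ₚ[] refl (⊗-zeroˡ p r (tail-≈ₚ[] e)))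

  ⊗-congʳ : ∀ p {r r′} → r ≈ₚ r′ → (p ⊗ r) ≈ₚ (p ⊗ r′)
  ⊗-congʳ []      e = ≈ₚ-refl
  ⊗-congʳ (x ∷ p) e = ⊕-cong (scale-cong refl e) (∷-cong refl (⊗-congʳ p e))

  ⊗-congˡ : ∀ p p′ r → p ≈ₚ p′ → (p ⊗ r) ≈ₚ (p′ ⊗ r)
  ⊗-congˡ []      []       r e = ≈ₚ-refl
  ⊗-congˡ []      (y ∷ p′) r e = ≈ₚ-sym (⊗-zeroˡ (y ∷ p′) r (≈ₚ-sym e))
  ⊗-congˡ (x ∷ p) []       r e = ⊗-zeroˡ (x ∷ p) r e
  ⊗-congˡ (x ∷ p) (y ∷ p′) r e =
    ⊕-cong (scale-cong (at e zero) ≈ₚ-refl) (∷-cong refl (⊗-congˡ p p′ r (tail-≈ₚ e)))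

  ⊗-cong : ∀ {p p′ r r′} → p ≈ₚ p′ → r ≈ₚ r′ → (p ⊗ r) ≈ₚ (p′ ⊗ r′)
  ⊗-cong {p} {p′} {r} e f = ≈ₚ-trans (⊗-congˡ p p′ r e) (⊗-congʳ p′ f)

  const-⊗ : ∀ x p → ((x ∷ []) ⊗ p) ≈ₚ scale x p
  const-⊗ x p = ≈ₚ-trans (⊕-cong ≈ₚ-refl (∷-≈ₚ[] refl ≈ₚ-refl)) (⊕-identityʳ (scale x p))

  X-⊗ : ∀ p → (X ⊗ p) ≈ₚ (0# ∷ p)
  X-⊗ p = ⊕-cong (scale-zero p) (∷-cong refl (≈ₚ-trans (const-⊗ 1# p) (scale-one p)))

  ⊗-distribʳ : ∀ p r w → ((p ⊕ r) ⊗ w) ≈ₚ ((p ⊗ w) ⊕ (r ⊗ w))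
  ⊗-distribʳ []      r       w = ≈ₚ-refl
  ⊗-distribʳ (x ∷ p) []      w = ≈ₚ-sym (⊕-identityʳ _)
  ⊗-distribʳ (x ∷ p) (y ∷ r) w = begin
    scale (x + y) w ⊕ (0# ∷ ((p ⊕ r) ⊗ w))
      ≈⟨ ⊕-cong (scale-distribʳ x y w) (∷-cong (sym (+-identityˡ 0#)) (⊗-distribʳ p r w)) ⟩
    (scale x w ⊕ scale y w) ⊕ ((0# ∷ (p ⊗ w)) ⊕ (0# ∷ (r ⊗ w)))
      ≈⟨ ⊕-interchange (scale x w) (scale y w) (0# ∷ (p ⊗ w)) (0# ∷ (r ⊗ w)) ⟩
    ((x ∷ p) ⊗ w) ⊕ ((y ∷ r) ⊗ w) ∎
    where open ≈ₚ-Reasoning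

  ⊗-distribˡ : ∀ w p r → (w ⊗ (p ⊕ r)) ≈ₚ ((w ⊗ p) ⊕ (w ⊗ r))
  ⊗-distribˡ []      p r = ≈ₚ-refl
  ⊗-distribˡ (x ∷ w) p r = begin
    scale x (p ⊕ r) ⊕ (0# ∷ (w ⊗ (p ⊕ r)))
      ≈⟨ ⊕-cong (scale-distribˡ x p r) (∷-cong (sym (+-identityˡ 0#)) (⊗-distribˡ w p r)) ⟩
    (scale x p ⊕ scale x r) ⊕ ((0# ∷ (w ⊗ p)) ⊕ (0# ∷ (w ⊗ r)))
      ≈⟨ ⊕-interchange (scale x p) (scale x r) (0# ∷ (w ⊗ p)) (0# ∷ (w ⊗ r)) ⟩
    ((x ∷ w) ⊗ p) ⊕ ((x ∷ w) ⊗ r) ∎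
    where open ≈ₚ-Reasoning

  scale-⊗ˡ : ∀ a p r → (scale a p ⊗ r) ≈ₚ scale a (p ⊗ r)
  scale-⊗ˡ a []      r = ≈ₚ-refl
  scale-⊗ˡ a (x ∷ p) r = begin
    scale (a · x) r ⊕ (0# ∷ (scale a p ⊗ r))
      ≈⟨ ⊕-cong (scale-assoc a x r) (∷-cong (sym (zeroʳ a)) (scale-⊗ˡ a p r)) ⟩
    scale a (scale x r) ⊕ scale a (0# ∷ (p ⊗ r))
      ≈⟨ ≈ₚ-sym (scale-distribˡ a (scale x r) (0# ∷ (p ⊗ r))) ⟩
    scale a ((x ∷ p) ⊗ r) ∎
    where open ≈ₚ-Reasoning

  scale-⊗ʳ : ∀ a p r → (p ⊗ scale a r) ≈ₚ scale a (p ⊗ r)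
  scale-⊗ʳ a []      r = ≈ₚ-refl
  scale-⊗ʳ a (x ∷ p) r = begin
    scale x (scale a r) ⊕ (0# ∷ (p ⊗ scale a r))
      ≈⟨ ⊕-cong (scale-comm x a r) (∷-cong (sym (zeroʳ a)) (scale-⊗ʳ a p r)) ⟩
    scale a (scale x r) ⊕ scale a (0# ∷ (p ⊗ r))
      ≈⟨ ≈ₚ-sym (scale-distribˡ a (scale x r) (0# ∷ (p ⊗ r))) ⟩
    scale a ((x ∷ p) ⊗ r) ∎
    where open ≈ₚ-Reasoning

  ⊗-assoc : ∀ p r w → ((p ⊗ r) ⊗ w) ≈ₚ (p ⊗ (r ⊗ w))
  ⊗-assoc []      r w = ≈ₚ-refl
  ⊗-assoc (x ∷ p) r w = begin
    (scale x r ⊕ (0# ∷ (p ⊗ r))) ⊗ w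
      ≈⟨ ⊗-distribʳ (scale x r) (0# ∷ (p ⊗ r)) w ⟩
    (scale x r ⊗ w) ⊕ ((0# ∷ (p ⊗ r)) ⊗ w)
      ≈⟨ ⊕-cong (scale-⊗ˡ x r w) (⊕-cong (scale-zero w) (∷-cong refl (⊗-assoc p r w))) ⟩
    scale x (r ⊗ w) ⊕ (0# ∷ (p ⊗ (r ⊗ w))) ∎
    where open ≈ₚ-Reasoning

  const-∘ : ∀ x r → ((x ∷ []) ∘ₚ r) ≈ₚ (x ∷ [])
  const-∘ x r = ≈ₚ-trans (⊕-cong ≈ₚ-refl (⊗-zeroʳ r)) (⊕-identityʳ _)

  ∘-zero : ∀ p r → p ≈ₚ [] → (p ∘ₚ r) ≈ₚ []
  ∘-zero []      r e = ≈ₚ-refl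
  ∘-zero (x ∷ p) r e =
    ≈ₚ-trans (⊕-cong ≈ₚ-refl (≈ₚ-trans (⊗-congʳ r (∘-zero p r (tail-≈ₚ[] e))) (⊗-zeroʳ r)))
             (∷-≈ₚ[] (at e zero) ≈ₚ-refl)

  ∘-congˡ : ∀ p p′ r → p ≈ₚ p′ → (p ∘ₚ r) ≈ₚ (p′ ∘ₚ r)
  ∘-congˡ []      []       r e = ≈ₚ-refl
  ∘-congˡ []      (y ∷ p′) r e = ≈ₚ-sym (∘-zero (y ∷ p′) r (≈ₚ-sym e))
  ∘-congˡ (x ∷ p) []       r e = ∘-zero (x ∷ p) r e
  ∘-congˡ (x ∷ p) (y ∷ p′) r e =
    ⊕-cong (∷-cong (at e zero) ≈ₚ-refl) (⊗-congʳ r (∘-congˡ p p′ r (tail-≈ₚ e)))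

  ∘-congʳ : ∀ p {r r′} → r ≈ₚ r′ → (p ∘ₚ r) ≈ₚ (p ∘ₚ r′)
  ∘-congʳ []      e = ≈ₚ-refl
  ∘-congʳ (x ∷ p) e = ⊕-cong ≈ₚ-refl (⊗-cong e (∘-congʳ p e))

  ∘-⊕ : ∀ p p′ r → ((p ⊕ p′) ∘ₚ r) ≈ₚ ((p ∘ₚ r) ⊕ (p′ ∘ₚ r))
  ∘-⊕ []      p′       r = ≈ₚ-refl
  ∘-⊕ (x ∷ p) []       r = ≈ₚ-sym (⊕-identityʳ _)
  ∘-⊕ (x ∷ p) (y ∷ p′) r = begin
    (x + y ∷ []) ⊕ (r ⊗ ((p ⊕ p′) ∘ₚ r))
      ≈⟨ ⊕-cong ≈ₚ-refl (≈ₚ-trans (⊗-congʳ r (∘-⊕ p p′ r)) (⊗-distribˡ r _ _)) ⟩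
    ((x ∷ []) ⊕ (y ∷ [])) ⊕ ((r ⊗ (p ∘ₚ r)) ⊕ (r ⊗ (p′ ∘ₚ r)))
      ≈⟨ ⊕-interchange (x ∷ []) (y ∷ []) (r ⊗ (p ∘ₚ r)) (r ⊗ (p′ ∘ₚ r)) ⟩
    ((x ∷ p) ∘ₚ r) ⊕ ((y ∷ p′) ∘ₚ r) ∎
    where open ≈ₚ-Reasoning

  ∘-scale : ∀ a p r → (scale a p ∘ₚ r) ≈ₚ scale a (p ∘ₚ r)
  ∘-scale a []      r = ≈ₚ-refl
  ∘-scale a (x ∷ p) r = begin
    (a · x ∷ []) ⊕ (r ⊗ (scale a p ∘ₚ r))
      ≈⟨ ⊕-cong ≈ₚ-refl (≈ₚ-trans (⊗-congʳ r (∘-scale a p r)) (scale-⊗ʳ a r (p ∘ₚ r))) ⟩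
    scale a (x ∷ []) ⊕ scale a (r ⊗ (p ∘ₚ r))
      ≈⟨ ≈ₚ-sym (scale-distribˡ a (x ∷ []) (r ⊗ (p ∘ₚ r))) ⟩
    scale a ((x ∷ p) ∘ₚ r) ∎
    where open ≈ₚ-Reasoning

  ∘-⊗ : ∀ p p′ r → ((p ⊗ p′) ∘ₚ r) ≈ₚ ((p ∘ₚ r) ⊗ (p′ ∘ₚ r))
  ∘-⊗ []      p′ r = ≈ₚ-refl
  ∘-⊗ (x ∷ p) p′ r = begin
    (scale x p′ ⊕ (0# ∷ (p ⊗ p′))) ∘ₚ r
      ≈⟨ ∘-⊕ (scale x p′) (0# ∷ (p ⊗ p′)) r ⟩
    (scale x p′ ∘ₚ r) ⊕ ((0# ∷ []) ⊕ (r ⊗ ((p ⊗ p′) ∘ₚ r)))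
      ≈⟨ ⊕-cong (∘-scale x p′ r) (⊕-cong (∷-≈ₚ[] refl ≈ₚ-refl) (⊗-congʳ r (∘-⊗ p p′ r))) ⟩
    scale x (p′ ∘ₚ r) ⊕ (r ⊗ ((p ∘ₚ r) ⊗ (p′ ∘ₚ r)))
      ≈⟨ ⊕-cong (≈ₚ-sym (const-⊗ x (p′ ∘ₚ r))) (≈ₚ-sym (⊗-assoc r (p ∘ₚ r) (p′ ∘ₚ r))) ⟩
    ((x ∷ []) ⊗ (p′ ∘ₚ r)) ⊕ ((r ⊗ (p ∘ₚ r)) ⊗ (p′ ∘ₚ r))
      ≈⟨ ≈ₚ-sym (⊗-distribʳ (x ∷ []) (r ⊗ (p ∘ₚ r)) (p′ ∘ₚ r)) ⟩
    ((x ∷ p) ∘ₚ r) ⊗ (p′ ∘ₚ r) ∎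
    where open ≈ₚ-Reasoning

  ∘-assoc : ∀ p r w → ((p ∘ₚ r) ∘ₚ w) ≈ₚ (p ∘ₚ (r ∘ₚ w))
  ∘-assoc []      r w = ≈ₚ-refl
  ∘-assoc (x ∷ p) r w = begin
    ((x ∷ []) ⊕ (r ⊗ (p ∘ₚ r))) ∘ₚ w
      ≈⟨ ∘-⊕ (x ∷ []) (r ⊗ (p ∘ₚ r)) w ⟩
    ((x ∷ []) ∘ₚ w) ⊕ ((r ⊗ (p ∘ₚ r)) ∘ₚ w)
      ≈⟨ ⊕-cong (const-∘ x w) (∘-⊗ r (p ∘ₚ r) w) ⟩
    (x ∷ []) ⊕ ((r ∘ₚ w) ⊗ ((p ∘ₚ r) ∘ₚ w))
      ≈⟨ ⊕-cong ≈ₚ-refl (⊗-congʳ (r ∘ₚ w) (∘-assoc p r w)) ⟩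
    (x ∷ p) ∘ₚ (r ∘ₚ w) ∎
    where open ≈ₚ-Reasoning

  ∘-X : ∀ p → (p ∘ₚ X) ≈ₚ p
  ∘-X []      = ≈ₚ-refl
  ∘-X (x ∷ p) =
    ≈ₚ-trans (⊕-cong (≈ₚ-refl {x ∷ []}) (≈ₚ-trans (X-⊗ _) (∷-cong refl (∘-X p))))
             (∷-cong (+-identityʳ x) ≈ₚ-refl)

  shift : Carrier → Pol
  shift a = a ∷ 1# ∷ []

  shift-inverse : ∀ b d → b + d ≈ 0# → (shift b ∘ₚ shift d) ≈ₚ X
  shift-inverse b d b+d≈0 = ≈ₚ-trans inner (coeffwise λ
    { zero          → trans (+-cong refl (trans (+-identityʳ _) (*-identityʳ d))) b+d≈0
    ; (suc zero)    → trans (+-identityʳ _) (*-identityʳ 1#)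
    ; (suc (suc i)) → refl
    })
    where
    inner : (shift b ∘ₚ shift d) ≈ₚ ((b ∷ []) ⊕ (shift d ⊗ (1# ∷ [])))
    inner = ⊕-cong (≈ₚ-refl {b ∷ []}) (⊗-congʳ (shift d) (const-∘ 1# (shift d)))

  -- (X + a)·r = a·r + X·r; with Horner's scheme
  -- (x ∷ p)(X + a) = x + (X + a)·p(X + a) this gives the coefficient recurrence.
  shift-⊗ : ∀ a r → (shift a ⊗ r) ≈ₚ (scale a r ⊕ (0# ∷ r))
  shift-⊗ a r = ⊕-cong ≈ₚ-refl (∷-cong refl (≈ₚ-trans (const-⊗ 1# r) (scale-one r)))

  coeff-shift-zero : ∀ a x p →
    coeff ((x ∷ p) ∘ₚ shift a) 0 ≈ x + a · coeff (p ∘ₚ shift a) 0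
  coeff-shift-zero a x p = begin
    coeff ((x ∷ []) ⊕ (shift a ⊗ r)) 0      ≈⟨ coeff-⊕ (x ∷ []) (shift a ⊗ r) 0 ⟩
    x + coeff (shift a ⊗ r) 0               ≈⟨ +-cong refl (at (shift-⊗ a r) 0) ⟩
    x + coeff (scale a r ⊕ (0# ∷ r)) 0      ≈⟨ +-cong refl (coeff-⊕ (scale a r) (0# ∷ r) 0) ⟩
    x + (coeff (scale a r) 0 + 0#)          ≈⟨ +-cong refl (trans (+-identityʳ _) (coeff-scale a r 0)) ⟩
    x + a · coeff r 0                       ∎
    where
    open ≈-Reasoning
    r = p ∘ₚ shift a

  coeff-shift-suc : ∀ a x p i →
    coeff ((x ∷ p) ∘ₚ shift a) (suc i) ≈ a · coeff (p ∘ₚ shift a) (suc i) + coeff (p ∘ₚ shift a) i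
  coeff-shift-suc a x p i = begin
    coeff ((x ∷ []) ⊕ (shift a ⊗ r)) (suc i)   ≈⟨ coeff-⊕ (x ∷ []) (shift a ⊗ r) (suc i) ⟩
    0# + coeff (shift a ⊗ r) (suc i)           ≈⟨ +-identityˡ _ ⟩
    coeff (shift a ⊗ r) (suc i)                ≈⟨ at (shift-⊗ a r) (suc i) ⟩
    coeff (scale a r ⊕ (0# ∷ r)) (suc i)       ≈⟨ coeff-⊕ (scale a r) (0# ∷ r) (suc i) ⟩
    coeff (scale a r) (suc i) + coeff r i      ≈⟨ +-cong (coeff-scale a r (suc i)) refl ⟩
    a · coeff r (suc i) + coeff r i            ∎
    where
    open ≈-Reasoning
    r = p ∘ₚ shift a

  VanishesAbove : Pol → ℕ → Set ℓ
  VanishesAbove p d = ∀ i → d < i → coeff p i ≈ 0#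

  vanishes-tail : ∀ {x p d} → VanishesAbove (x ∷ p) (suc d) → VanishesAbove p d
  vanishes-tail v i d<i = v (suc i) (s≤s d<i)

  vanishes-tail₀ : ∀ {x p} → VanishesAbove (x ∷ p) 0 → p ≈ₚ []
  vanishes-tail₀ v = coeffwise λ i → v (suc i) (s≤s z≤n)

  shift-suc-vanishes : ∀ a x p i → coeff (p ∘ₚ shift a) (suc i) ≈ 0# → coeff (p ∘ₚ shift a) i ≈ 0# →
    coeff ((x ∷ p) ∘ₚ shift a) (suc i) ≈ 0#
  shift-suc-vanishes a x p i z₁ z₂ =
    trans (coeff-shift-suc a x p i) (trans (+-cong (trans (*-cong refl z₁) (zeroʳ a)) z₂) (+-identityˡ 0#))

  shift-vanishes : ∀ a p d → VanishesAbove p d → VanishesAbove (p ∘ₚ shift a) d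
  shift-vanishes a []      d       v i       _         = refl
  shift-vanishes a (x ∷ p) zero    v (suc i) _         =
    shift-suc-vanishes a x p i (at p∘S≈[] (suc i)) (at p∘S≈[] i)
    where p∘S≈[] = ∘-zero p (shift a) (vanishes-tail₀ v)
  shift-vanishes a (x ∷ p) (suc d) v (suc i) (s≤s d<i) =
    shift-suc-vanishes a x p i (IH (suc i) (ℕₚ.m<n⇒m<1+n d<i)) (IH i d<i)
    where IH = shift-vanishes a p d (vanishes-tail v)

  shift-leading : ∀ a p d → VanishesAbove p d → coeff (p ∘ₚ shift a) d ≈ coeff p d
  shift-leading a []      d       v = refl
  shift-leading a (x ∷ p) zero    v = begin
    coeff ((x ∷ p) ∘ₚ shift a) 0    ≈⟨ coeff-shift-zero a x p ⟩
    x + a · coeff (p ∘ₚ shift a) 0  ≈⟨ +-cong refl (*-cong refl (at (∘-zero p (shift a) (vanishes-tail₀ v)) 0)) ⟩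
    x + a · 0#                      ≈⟨ +-cong refl (zeroʳ a) ⟩
    x + 0#                          ≈⟨ +-identityʳ x ⟩
    x                               ∎
    where open ≈-Reasoning
  shift-leading a (x ∷ p) (suc d) v = begin
    coeff ((x ∷ p) ∘ₚ shift a) (suc d)                        ≈⟨ coeff-shift-suc a x p d ⟩
    a · coeff (p ∘ₚ shift a) (suc d) + coeff (p ∘ₚ shift a) d ≈⟨ +-cong (*-cong refl top) (shift-leading a p d v′) ⟩
    a · 0# + coeff p d                                        ≈⟨ +-cong (zeroʳ a) refl ⟩
    0# + coeff p d                                            ≈⟨ +-identityˡ _ ⟩
    coeff p d                                                 ∎
    where
    open ≈-Reasoning
    v′  = vanishes-tail v
    top = shift-vanishes a p d v′ (suc d) (ℕₚ.n<1+n d)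

  shift-degree : ∀ a p {d} → HasDegree p d → HasDegree (p ∘ₚ shift a) d
  shift-degree a p {d} (top≉0 , v) = (λ top≈0 → top≉0 (trans (sym (shift-leading a p d v)) top≈0))
                                      , shift-vanishes a p d v

  shift-subleading : ∀ a p d → VanishesAbove p (suc d) →
    coeff (p ∘ₚ shift a) d ≈ coeff p d + (suc d times 1#) · (a · coeff p (suc d))
  shift-subleading a []      d       v = sym (trans (+-identityˡ _) (trans (*-cong refl (zeroʳ a)) (zeroʳ _)))
  shift-subleading a (x ∷ p) zero    v = begin
    coeff ((x ∷ p) ∘ₚ shift a) 0              ≈⟨ coeff-shift-zero a x p ⟩
    x + a · coeff (p ∘ₚ shift a) 0            ≈⟨ +-cong refl (*-cong refl (shift-leading a p 0 (vanishes-tail v))) ⟩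
    x + a · coeff p 0                         ≈⟨ +-cong refl (sym (trans (*-cong (+-identityʳ 1#) refl) (*-identityˡ _))) ⟩
    x + (1 times 1#) · (a · coeff p 0)            ∎
    where open ≈-Reasoning
  shift-subleading a (x ∷ p) (suc d) v = begin
    coeff ((x ∷ p) ∘ₚ shift a) (suc d)
      ≈⟨ coeff-shift-suc a x p d ⟩
    a · coeff (p ∘ₚ shift a) (suc d) + coeff (p ∘ₚ shift a) d
      ≈⟨ +-cong (*-cong refl (shift-leading a p (suc d) v′)) (shift-subleading a p d v′) ⟩
    y + (coeff p d + (suc d times 1#) · y)
      ≈⟨ x∙yz≈y∙xz y (coeff p d) _ ⟩
    coeff p d + (y + (suc d times 1#) · y)
      ≈⟨ +-cong refl (sym (trans (distribʳ y 1# (suc d times 1#)) (+-cong (*-identityˡ y) refl))) ⟩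
    coeff p d + (suc (suc d) times 1#) · y
      ∎
    where
    open ≈-Reasoning
    v′ = vanishes-tail v
    y  = a · coeff p (suc d)

  HasDegree-resp : ∀ {p p′ d} → p ≈ₚ p′ → HasDegree p′ d → HasDegree p d
  HasDegree-resp {d = d} e (top≉0 , v) = (λ top≈0 → top≉0 (trans (sym (at e d)) top≈0))
                                       , λ i d<i → trans (at e i) (v i d<i)

  unshift : ∀ b d → b + d ≈ 0# → ∀ p → ((p ∘ₚ shift b) ∘ₚ shift d) ≈ₚ p
  unshift b d b+d≈0 p = begin
    (p ∘ₚ shift b) ∘ₚ shift d ≈⟨ ∘-assoc p (shift b) (shift d) ⟩
    p ∘ₚ (shift b ∘ₚ shift d) ≈⟨ ∘-congʳ p (shift-inverse b d b+d≈0) ⟩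
    p ∘ₚ X                    ≈⟨ ∘-X p ⟩
    p                         ∎
    where open ≈ₚ-Reasoning

  unshift-constant : ∀ a p → HasDegree (p ∘ₚ shift a) 0 → HasDegree p 0
  unshift-constant a p (k≉0 , v) = HasDegree-resp p≈k (k≉0 , λ { (suc i) _ → refl })
    where
    k = coeff (p ∘ₚ shift a) 0
    p∘S≈k : (p ∘ₚ shift a) ≈ₚ (k ∷ [])
    p∘S≈k = coeffwise λ { zero → refl ; (suc i) → v (suc i) (s≤s z≤n) }
    p≈k : p ≈ₚ (k ∷ [])
    p≈k = begin
      p                               ≈⟨ ≈ₚ-sym (unshift a (- a) (-‿inverseʳ a) p) ⟩
      (p ∘ₚ shift a) ∘ₚ shift (- a)   ≈⟨ ∘-congˡ (p ∘ₚ shift a) (k ∷ []) (shift (- a)) p∘S≈k ⟩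
      (k ∷ []) ∘ₚ shift (- a)         ≈⟨ const-∘ k (shift (- a)) ⟩
      k ∷ []                          ∎
      where open ≈ₚ-Reasoning

  -- Irreducibility is invariant under X ↦ X + a: a factorisation g·h of
  -- p(X + a) is carried back by X ↦ X - a to the factorisation
  -- g(X - a)·h(X - a) of p, one of whose factors must be constant.
  shift-irreducible : ∀ a p → Irreducible p → Irreducible (p ∘ₚ shift a)
  shift-irreducible a p ((d , 1≤d , deg-p) , factors-p) = (d , 1≤d , shift-degree a p deg-p) , factors
    where
    factors : ∀ g h → (p ∘ₚ shift a) ≃ (g ⊗ h) → HasDegree g 0 ⊎ HasDegree h 0
    factors g h p∘S≃gh = Sum.map (unshift-constant (- a) g) (unshift-constant (- a) h)
                                 (factors-p (g ∘ₚ shift (- a)) (h ∘ₚ shift (- a)) (at pulled-back))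
      where
      open ≈ₚ-Reasoning
      pulled-back : p ≈ₚ ((g ∘ₚ shift (- a)) ⊗ (h ∘ₚ shift (- a)))
      pulled-back = begin
        p                                         ≈⟨ ≈ₚ-sym (unshift a (- a) (-‿inverseʳ a) p) ⟩
        (p ∘ₚ shift a) ∘ₚ shift (- a)             ≈⟨ ∘-congˡ (p ∘ₚ shift a) (g ⊗ h) (shift (- a)) (coeffwise p∘S≃gh) ⟩
        (g ⊗ h) ∘ₚ shift (- a)                    ≈⟨ ∘-⊗ g h (shift (- a)) ⟩
        (g ∘ₚ shift (- a)) ⊗ (h ∘ₚ shift (- a))   ∎

  X² : Pol
  X² = 0# ∷ 0# ∷ 1# ∷ []

  X²-⊗ : ∀ p → (X² ⊗ p) ≈ₚ (0# ∷ 0# ∷ p)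
  X²-⊗ p = ⊕-cong (scale-zero p) (∷-cong refl (X-⊗ p))

  even-odd-coeff : ∀ A m → coeff (A ∘ₚ X²) (suc (m * 2)) ≈ 0#
  even-odd-coeff []      m = refl
  even-odd-coeff (x ∷ A) m = begin
    coeff ((x ∷ []) ⊕ (X² ⊗ r)) (suc (m * 2))  ≈⟨ coeff-⊕ (x ∷ []) (X² ⊗ r) (suc (m * 2)) ⟩
    0# + coeff (X² ⊗ r) (suc (m * 2))          ≈⟨ +-identityˡ _ ⟩
    coeff (X² ⊗ r) (suc (m * 2))               ≈⟨ at (X²-⊗ r) (suc (m * 2)) ⟩
    coeff (0# ∷ 0# ∷ r) (suc (m * 2))          ≈⟨ odd-tail m ⟩
    0#                                         ∎
    where
    open ≈-Reasoning
    r = A ∘ₚ X²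
    odd-tail : ∀ k → coeff (0# ∷ 0# ∷ r) (suc (k * 2)) ≈ 0#
    odd-tail zero    = refl
    odd-tail (suc k) = even-odd-coeff A k

  -- For B = A(X²) monic of degree 2n, the coefficient of X^{2n-1} in B(X + a)
  -- is B_{2n-1} + 2n·a·B_{2n} = 0 + 2n·a.
  even-monic-shift-coeff : ∀ a A B m → B ≃ (A ∘ₚ X²) → MonicOfDegree B (suc m * 2) →
    coeff (B ∘ₚ shift a) (suc (m * 2)) ≈ (suc m * 2) times 1# · a
  even-monic-shift-coeff a A B m B≃A∘X² (B-top≈1 , B-above) = begin
    coeff (B ∘ₚ shift a) d                           ≈⟨ shift-subleading a B d B-above ⟩
    coeff B d + 2n times 1# · (a · coeff B (suc d))  ≈⟨ +-cong B-odd (*-cong refl (*-cong refl B-top≈1)) ⟩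
    0# + 2n times 1# · (a · 1#)                      ≈⟨ +-identityˡ _ ⟩
    2n times 1# · (a · 1#)                           ≈⟨ *-cong refl (*-identityʳ a) ⟩
    2n times 1# · a                                  ∎
    where
    open ≈-Reasoning
    d  = suc (m * 2)
    2n = suc m * 2
    B-odd : coeff B d ≈ 0#
    B-odd = trans (B≃A∘X² d) (even-odd-coeff A m)

module ListSums {a ℓ} (M : CommutativeMonoid a ℓ) where
  open CommutativeMonoid M
  open CommutativeSemigroupProperties commutativeSemigroup using (x∙yz≈y∙xz)
  open import Data.List.Membership.Setoid setoid using (_∈_)

  Σ : List Carrier → Carrier
  Σ = foldr _∙_ ε

  Distinct : List Carrier → Set (a Level.⊔ ℓ)
  Distinct = AllPairs (λ x y → ¬ x ≈ y)

  Σ-─ : ∀ {x xs} (x∈xs : x ∈ xs) → Σ xs ≈ x ∙ Σ (xs ─ x∈xs)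
  Σ-─ (here x≈y)  = ∙-cong (sym x≈y) refl
  Σ-─ (there x∈ys) = trans (∙-cong refl (Σ-─ x∈ys)) (x∙yz≈y∙xz _ _ _)

  ∈-─ : ∀ {x z xs} (x∈xs : x ∈ xs) → z ∈ xs → ¬ z ≈ x → z ∈ (xs ─ x∈xs)
  ∈-─ (here x≈y)  (here z≈y)   z≉x = ⊥-elim (z≉x (trans z≈y (sym x≈y)))
  ∈-─ (here _)    (there z∈ys) _   = z∈ys
  ∈-─ (there _)   (here z≈y)   _   = here z≈y
  ∈-─ (there x∈ys) (there z∈ys) z≉x = there (∈-─ x∈ys z∈ys z≉x)

  -- A duplicate-free list ys whose elements all occur in a list xs of the
  -- same length is a rearrangement of xs, so it has the same sum.
  Σ-rearrange : ∀ xs ys → Distinct ys → All (_∈ xs) ys → length xs ≡ length ys → Σ xs ≈ Σ ys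
  Σ-rearrange []       []       _                 _               _   = refl
  Σ-rearrange (_ ∷ _)  []       _                 _               ()
  Σ-rearrange xs       (y ∷ ys) (y≉ys ∷ distinct) (y∈xs ∷ ys⊆xs) len =
    trans (Σ-─ y∈xs) (∙-cong refl (Σ-rearrange (xs ─ y∈xs) ys distinct ys⊆rest len′))
    where
    ys⊆rest : All (_∈ (xs ─ y∈xs)) ys
    ys⊆rest = All.zipWith (λ (z∈xs , y≉z) → ∈-─ y∈xs z∈xs (λ z≈y → y≉z (sym z≈y))) (ys⊆xs , y≉ys)
    len′ : length (xs ─ y∈xs) ≡ length ys
    len′ = ℕₚ.suc-injective (≡.trans (≡.sym (ListProperties.length-removeAt′ xs (index y∈xs))) len)

module Characteristic {c ℓ} (R : CommutativeRing c ℓ) where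
  open CommutativeRing R hiding (zero) renaming (_*_ to _·_)
  open CommutativeSemigroupProperties +-commutativeSemigroup using (interchange)
  open MultProperties semiring using (×1-homo-*) renaming (_×_ to _times_)
  open GroupProperties +-group using (identityˡ-unique; ∙-cancelˡ)
  open ListSums +-commutativeMonoid using (Σ; Distinct; Σ-rearrange)
  open import Data.List.Membership.Setoid setoid using (_∈_)

  Σ-translate : ∀ xs → Σ (map (1# +_) xs) ≈ length xs times 1# + Σ xs
  Σ-translate []       = sym (+-identityˡ 0#)
  Σ-translate (x ∷ xs) = trans (+-cong refl (Σ-translate xs)) (interchange 1# x _ _)

  -- A ring enumerated without repetitions by a list of length q satisfies
  -- q·1 = 0: translation by 1 permutes the elements, so Σ x = q·1 + Σ x.
  enumeration-characteristic : ∀ xs → (∀ x → x ∈ xs) → Distinct xs → length xs times 1# ≈ 0#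
  enumeration-characteristic xs complete distinct = identityˡ-unique _ (Σ xs) (sym Σxs≈q+Σxs)
    where
    translates-distinct : Distinct (map (1# +_) xs)
    translates-distinct = AllPairsProperties.map⁺ (AllPairs.map (λ x≉y 1+x≈1+y → x≉y (∙-cancelˡ 1# _ _ 1+x≈1+y)) distinct)
    Σxs≈q+Σxs : Σ xs ≈ length xs times 1# + Σ xs
    Σxs≈q+Σxs = trans (Σ-rearrange xs (map (1# +_) xs) translates-distinct (All.tabulate λ {x} _ → complete x)
                                   (≡.sym (ListProperties.length-map (1# +_) xs)))
                      (Σ-translate xs)

  bezout-collapse : ∀ {a b} u v → a times 1# ≈ 0# → b times 1# ≈ 0# → 1 ℕ.+ u * a ≡ v * b → 1# ≈ 0#
  bezout-collapse {a} {b} u v a≈0 b≈0 bezout = begin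
    1#                          ≈⟨ sym (+-identityʳ 1#) ⟩
    1# + 0#                     ≈⟨ +-cong refl (sym (vanishing u a≈0)) ⟩
    (1 ℕ.+ u * a) times 1#      ≡⟨ ≡.cong (_times 1#) bezout ⟩
    (v * b) times 1#            ≈⟨ vanishing v b≈0 ⟩
    0#                          ∎
    where
    open SetoidReasoning setoid
    vanishing : ∀ w {k} → k times 1# ≈ 0# → (w * k) times 1# ≈ 0#
    vanishing w {k} k≈0 = trans (×1-homo-* w k) (trans (*-cong refl k≈0) (zeroʳ _))

  coprime-nonzero : ¬ 1# ≈ 0# → ∀ q k → q times 1# ≈ 0# → gcd k q ≡ 1 → ¬ k times 1# ≈ 0#
  coprime-nonzero 1≉0 q k q≈0 coprime k≈0
    with GCD.Bézout.identity (≡.subst (GCD.GCD k q) coprime (GCD.gcd-GCD k q))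
  ... | GCD.Bézout.+- x y eq = 1≉0 (bezout-collapse y x q≈0 k≈0 eq)
  ... | GCD.Bézout.-+ x y eq = 1≉0 (bezout-collapse x y k≈0 q≈0 eq)

  odd-two-nonzero : ¬ 1# ≈ 0# → ∀ q → q times 1# ≈ 0# → q % 2 ≡ 1 → ¬ 2 times 1# ≈ 0#
  odd-two-nonzero 1≉0 q q≈0 odd two≈0 = 1≉0 (bezout-collapse (q ℕ./ 2) 1 two≈0 q≈0 1+[q/2]*2≡q)
    where
    1+[q/2]*2≡q : 1 ℕ.+ (q ℕ./ 2) * 2 ≡ 1 * q
    1+[q/2]*2≡q = ≡.trans (≡.cong (ℕ._+ (q ℕ./ 2) * 2) (≡.sym odd))
                          (≡.trans (≡.sym (DivMod.m≡m%n+[m/n]*n q 2)) (≡.sym (ℕₚ.*-identityˡ q)))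

module FiniteFieldArithmetic {c ℓ q} (𝔽 : FiniteField c ℓ q) where
  open FiniteField 𝔽
  open CommutativeRing commRing hiding (zero) renaming (_*_ to _·_)
  open MultProperties semiring using (×1-homo-*) renaming (_×_ to _times_)
  open Characteristic commRing

  characteristic : q times 1# ≈ 0#
  characteristic = ≡.subst (λ n → n times 1# ≈ 0#) size (enumeration-characteristic elements complete distinct)

  ·-nonzero : ∀ {x y} → ¬ x ≈ 0# → ¬ y ≈ 0# → ¬ x · y ≈ 0#
  ·-nonzero {x} {y} x≉0 y≉0 xy≈0 with inverse y y≉0
  ... | y⁻¹ , yy⁻¹≈1 = x≉0 (begin
    x              ≈⟨ sym (*-identityʳ x) ⟩
    x · 1#         ≈⟨ *-cong refl (sym yy⁻¹≈1) ⟩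
    x · (y · y⁻¹)  ≈⟨ sym (*-assoc x y y⁻¹) ⟩
    (x · y) · y⁻¹  ≈⟨ *-cong xy≈0 refl ⟩
    0# · y⁻¹       ≈⟨ zeroˡ y⁻¹ ⟩
    0#             ∎)
    where open SetoidReasoning setoid

  double-nonzero : q % 2 ≡ 1 → ∀ n → gcd n q ≡ 1 → ¬ (n * 2) times 1# ≈ 0#
  double-nonzero q-odd n coprime =
    λ 2n≈0 → ·-nonzero n≉0 2≉0 (trans (sym (×1-homo-* n 2)) 2n≈0)
    where
    n≉0 = coprime-nonzero nontrivial q n characteristic coprime
    2≉0 = odd-two-nonzero nontrivial q characteristic q-odd

proposition2 : ∀ {c ℓ : Level} (q : ℕ) (𝔽 : FiniteField c ℓ q) →
    IsPrimePower q → q % 2 ≡ 1 →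
    let open Poly (FiniteField.commRing 𝔽) in
    (n : ℕ) → 1 ≤ n → gcd n q ≡ 1 →
    (B : Pol) → MonicOfDegree B (2 * n) → Irreducible B →
    (∃[ A ] (B ≃ (A ∘ₚ (0# ∷ 0# ∷ 1# ∷ [])))) →
    (a : Carrier) → ¬ (a ≈ 0#) →
    Irreducible (B ∘ₚ (a ∷ 1# ∷ [])) ×
    (∃[ i ] (i % 2 ≡ 1 × i < 2 * n × ¬ (coeff (B ∘ₚ (a ∷ 1# ∷ [])) i ≈ 0#)))
proposition2 q 𝔽 _ q-odd n@(suc m) _ coprime B B-monic B-irreducible (A , B≃A∘X²) a a≉0 =
  shift-irreducible a B B-irreducible , d , odd-d , d<2n , coeff-d-nonzero
  where
  open FiniteField 𝔽 using (commRing)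
  open CommutativeRing commRing hiding (zero) renaming (_*_ to _·_)
  open MultProperties semiring using () renaming (_×_ to _times_)
  open Poly commRing using (coeff; _∘ₚ_; MonicOfDegree)
  open Polynomials commRing
  open FiniteFieldArithmetic 𝔽

  -- the odd index d = 2n - 1; note d + 1 = n * 2 definitionally
  d : ℕ
  d = suc (m * 2)

  2n≡n*2 : 2 * n ≡ n * 2
  2n≡n*2 = ℕₚ.*-comm 2 n

  odd-d : d % 2 ≡ 1
  odd-d = DivMod.[m+kn]%n≡m%n 1 m 2

  d<2n : d < 2 * n
  d<2n = ≡.subst (d <_) (≡.sym 2n≡n*2) (ℕₚ.n<1+n d)

  -- B(X + a)_d = 2n·a is a product of nonzero elements of the field.
  coeff-d-nonzero : ¬ coeff (B ∘ₚ shift a) d ≈ 0#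
  coeff-d-nonzero coeff-d≈0 = ·-nonzero (double-nonzero q-odd n coprime) a≉0 (begin
    (n * 2) times 1# · a    ≈⟨ even-monic-shift-coeff a A B m B≃A∘X² (≡.subst (MonicOfDegree B) 2n≡n*2 B-monic) ⟨
    coeff (B ∘ₚ shift a) d  ≈⟨ coeff-d≈0 ⟩
    0#                      ∎)
    where open SetoidReasoning setoid
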